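{- Let $G$ be a nice graph and $s$ a shallow terminal of $G$. Then $G$ contains an induced $\dagger$- or $\ddagger$-AW each of whose base vertices is adjacent to all vertices of $N(s)\setminus ST(G)$.
   Context: Graphs are finite, simple, undirected. A minimal forbidden set is $X\subseteq V(G)$ with $G[X]$ not an interval graph but every proper subset inducing an interval graph; $G$ is prereduced if it has no minimal forbidden set of at most $10$ vertices. A $\dagger$-AW $(s:c:l,B,r)$, $B=\{b_1,\dots,b_d\}$, $d\ge 3$, $b_0=l$, $b_{d+1}=r$: vertices $s,c,b_0,\dots,b_{d+1}$ with edges exactly $b_ib_{i+1}$ $(0\le i\le d)$, $cs$, $cb_i$ $(1\le i\le d)$. A $\ddagger$-AW $(s:c_1,c_2:l,B,r)$, $d\ge 2$: vertices $s,c_1,c_2,b_0,\dots,b_{d+1}$ with edges exactly $b_ib_{i+1}$, $c_1c_2$, $c_1s$, $c_2s$, $c_1l$, $c_2r$, $c_jb_i$ ($j=1,2$, $1\le i\le d$). Here $s$ is the shallow terminal and $b_1,\dots,b_d$ are the base vertices. A shallow terminal of $G$ is the shallow terminal of some induced $\dagger$- or $\ddagger$-AW of $G$, and $ST(G)$ is the set of all shallow terminals of $G$. $G$ is nice if it is prereduced, chordal, and every shallow terminal of $G$ is simplicial. -}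

module Defs where

open import Data.Nat using (ℕ; zero; suc; _+_; _≤_; _≡ᵇ_; _≤ᵇ_)
open import Data.Bool using (Bool; true; false; _∧_; _∨_)
open import Data.Fin using (Fin; toℕ)
open import Data.Fin.Subset using (Subset; _∈_; _⊂_; ∣_∣)
open import Data.Product using (Σ; ∃; _×_)
open import Data.Sum using (_⊎_)
open import Relation.Nullary using (¬_)
open import Relation.Binary.PropositionalEquality using (_≡_; _≢_)
open import Function.Bundles using (_⇔_)
open import Function.Definitions using (Injective)

record Graph : Set where
  field
    n      : ℕ
    adj    : Fin n → Fin n → Bool
    sym    : ∀ u v → adj u v ≡ adj v u
    irrefl : ∀ v → adj v v ≡ false

open Graph public

Adj : (G : Graph) → Fin (n G) → Fin (n G) → Set
Adj G u v = adj G u v ≡ true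

-- G[X] is an interval graph: each vertex of X gets a closed interval
-- [lo v , hi v] (integer endpoints suffice for finite graphs) such that
-- two distinct vertices of X are adjacent iff their intervals intersect.
IsIntervalOn : (G : Graph) → Subset (n G) → Set
IsIntervalOn G X =
  Σ (Fin (n G) → ℕ) λ lo → Σ (Fin (n G) → ℕ) λ hi →
    (∀ v → v ∈ X → lo v ≤ hi v) ×
    (∀ u v → u ∈ X → v ∈ X → u ≢ v →
       (Adj G u v ⇔ (lo u ≤ hi v × lo v ≤ hi u)))

MinimalForbidden : (G : Graph) → Subset (n G) → Set
MinimalForbidden G X =
  ¬ IsIntervalOn G X × (∀ Y → Y ⊂ X → IsIntervalOn G Y)

Prereduced : Graph → Set
Prereduced G = ∀ X → ∣ X ∣ ≤ 10 → ¬ MinimalForbidden G X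

Consec : (k : ℕ) → Fin k → Fin k → Set
Consec k i j = (suc (toℕ i) ≡ toℕ j) ⊎ ((suc (toℕ i) ≡ k) × (toℕ j ≡ 0))

Chordal : Graph → Set
Chordal G =
  ∀ (m : ℕ) (f : Fin (m + 4) → Fin (n G)) → Injective _≡_ _≡_ f →
    (∀ i j → Consec (m + 4) i j → Adj G (f i) (f j)) →
    ∃ λ i → ∃ λ j → i ≢ j × ¬ Consec (m + 4) i j × ¬ Consec (m + 4) j i
                     × Adj G (f i) (f j)

Simplicial : (G : Graph) → Fin (n G) → Set
Simplicial G s = ∀ u v → Adj G s u → Adj G s v → u ≢ v → Adj G u v

-- Vertices of an asteroidal witness with k centre vertices and base path
-- b_0 = l, b_1, ..., b_d, b_{d+1} = r.
data AWV (k d : ℕ) : Set where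
  shallow : AWV k d
  centre  : Fin k → AWV k d
  base    : Fin (suc (suc d)) → AWV k d

pathAdj : {d : ℕ} → Fin (suc (suc d)) → Fin (suc (suc d)) → Bool
pathAdj i j = (suc (toℕ i) ≡ᵇ toℕ j) ∨ (suc (toℕ j) ≡ᵇ toℕ i)

inner : {d : ℕ} → Fin (suc (suc d)) → Bool
inner {d} i = (1 ≤ᵇ toℕ i) ∧ (toℕ i ≤ᵇ d)

isL : {d : ℕ} → Fin (suc (suc d)) → Bool
isL i = toℕ i ≡ᵇ 0

isR : {d : ℕ} → Fin (suc (suc d)) → Bool
isR {d} i = toℕ i ≡ᵇ suc d

daggerAdj : (d : ℕ) → AWV 1 d → AWV 1 d → Bool
daggerAdj d (base i)   (base j)   = pathAdj i j
daggerAdj d (centre _) shallow    = true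
daggerAdj d shallow    (centre _) = true
daggerAdj d (centre _) (base i)   = inner i
daggerAdj d (base i)   (centre _) = inner i
daggerAdj d _          _          = false

-- edge pattern of a ‡-AW (s : c₁ , c₂ : l , B , r); centre 0 = c₁, centre 1 = c₂
ddaggerAdj : (d : ℕ) → AWV 2 d → AWV 2 d → Bool
ddaggerAdj d (base i) (base j) = pathAdj i j
ddaggerAdj d (centre Fin.zero) (centre (Fin.suc Fin.zero)) = true
ddaggerAdj d (centre (Fin.suc Fin.zero)) (centre Fin.zero) = true
ddaggerAdj d (centre _) shallow = true
ddaggerAdj d shallow (centre _) = true
ddaggerAdj d (centre Fin.zero) (base i) = inner i ∨ isL i
ddaggerAdj d (base i) (centre Fin.zero) = inner i ∨ isL i
ddaggerAdj d (centre (Fin.suc Fin.zero)) (base i) = inner i ∨ isR i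
ddaggerAdj d (base i) (centre (Fin.suc Fin.zero)) = inner i ∨ isR i
ddaggerAdj d _ _ = false

InducedCopy : (G : Graph) {V : Set} → (V → V → Bool) → (V → Fin (n G)) → Set
InducedCopy G P φ = Injective _≡_ _≡_ φ × (∀ x y → adj G (φ x) (φ y) ≡ P x y)

DaggerAW : (G : Graph) (d : ℕ) → (AWV 1 d → Fin (n G)) → Set
DaggerAW G d φ = 3 ≤ d × InducedCopy G (daggerAdj d) φ

DDaggerAW : (G : Graph) (d : ℕ) → (AWV 2 d → Fin (n G)) → Set
DDaggerAW G d φ = 2 ≤ d × InducedCopy G (ddaggerAdj d) φ

ShallowTerminal : (G : Graph) → Fin (n G) → Set
ShallowTerminal G v =
  (∃ λ d → ∃ λ (φ : AWV 1 d → Fin (n G)) → DaggerAW G d φ × φ shallow ≡ v)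
  ⊎ (∃ λ d → ∃ λ (φ : AWV 2 d → Fin (n G)) → DDaggerAW G d φ × φ shallow ≡ v)

Nice : Graph → Set
Nice G = Prereduced G × Chordal G × (∀ v → ShallowTerminal G v → Simplicial G v)

BasesDominate : (G : Graph) {k d : ℕ} → (AWV k d → Fin (n G)) → Fin (n G) → Set
BasesDominate G {k} {d} φ s =
  ∀ (i : Fin (suc (suc d))) → inner i ≡ true →
  ∀ (w : Fin (n G)) → Adj G s w → ¬ ShallowTerminal G w → Adj G (φ (base i)) w

-- Induction on the number of base vertices of an AW with shallow terminal s.  Let w ∈ N(s)
-- miss an inner base vertex b_i; as s is simplicial, w sees every centre.  If w misses the
-- whole base path, w can take the place of s, so w ∈ ST(G).  If w has base neighbours on both
-- sides of b_i, w closes a hole with the path, against chordality.  If only on one side, the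
-- run of neighbours of w ending at its base neighbour nearest to b_i gives either an
-- asteroidal triple on at most 10 vertices, against prereducedness, or, with s and a centre,
-- a smaller †- or ‡-AW whose shallow terminal is still s.

module Submission where

open import Defs hiding (sym)
open import Data.Nat using (ℕ; zero; suc; _+_; _∸_; _≤_; _<_; z≤n; s≤s; _≤?_; _<?_; _≟_; _≡ᵇ_; _≤ᵇ_)
open import Data.Nat.Properties
open import Data.Nat.Induction using (<-wellFounded)
open import Data.Bool using (Bool; true; false; _∧_; _∨_)
open import Data.Bool.Properties using (T-≡; ⇔→≡; ¬-not) renaming (_≟_ to _≟ᵇ_)
open import Data.Fin using (Fin; toℕ; fromℕ<) renaming (zero to fzero; suc to fsuc; _≟_ to _≟ᶠ_)
open import Data.Fin.Properties using (toℕ<n; toℕ-injective; toℕ-fromℕ<)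
open import Data.Fin.Subset using (Subset; _∈_; _⊂_; ∣_∣; inside; outside) renaming (⊥ to ∅)
open import Data.Fin.Subset.Properties using (p⊂q⇒∣p∣<∣q∣; ∣⊥∣≡0)
open import Data.Vec using ([]; _∷_; here; there)
open import Data.List using (List; []; _∷_; length)
open import Data.List.Relation.Unary.Any using () renaming (here to here′; there to there′)
open import Data.List.Membership.Propositional using () renaming (_∈_ to _∈ₗ_)
open import Data.Product using (Σ; ∃; _×_; _,_; proj₁; proj₂)
open import Data.Sum using (_⊎_; inj₁; inj₂; [_,_]′)
open import Data.Sum.Function.Propositional using (_⊎-⇔_)
open import Data.Empty using (⊥; ⊥-elim)
open import Function using (_∘_; case_of_)
open import Function.Bundles using (_⇔_; mk⇔; Equivalence)
open import Function.Properties.Equivalence using () renaming (trans to ⇔-trans; sym to ⇔-sym)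
open import Induction.WellFounded using (Acc; acc)
open import Relation.Binary.Definitions using (tri<; tri≈; tri>)
open import Relation.Nullary using (¬_; Dec; yes; no)
open import Relation.Nullary.Decidable using (¬?; decidable-stable)
open import Relation.Binary.PropositionalEquality

≡ᵇ-true⇔ : ∀ {m n} → (m ≡ᵇ n) ≡ true ⇔ m ≡ n
≡ᵇ-true⇔ {m} {n} = mk⇔ (≡ᵇ⇒≡ m n ∘ Equivalence.from T-≡) (Equivalence.to T-≡ ∘ ≡⇒≡ᵇ m n)

≤ᵇ-true⇔ : ∀ {m n} → (m ≤ᵇ n) ≡ true ⇔ m ≤ n
≤ᵇ-true⇔ {m} {n} = mk⇔ (≤ᵇ⇒≤ m n ∘ Equivalence.from T-≡) (Equivalence.to T-≡ ∘ ≤⇒≤ᵇ)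

∧-true⇔ : ∀ {x y} → (x ∧ y) ≡ true ⇔ (x ≡ true × y ≡ true)
∧-true⇔ {true} {true} = mk⇔ (λ _ → refl , refl) (λ _ → refl)
∧-true⇔ {true} {false} = mk⇔ (λ ()) (λ ())
∧-true⇔ {false} = mk⇔ (λ ()) (λ ())

∨-true⇔ : ∀ {x y} → (x ∨ y) ≡ true ⇔ (x ≡ true ⊎ y ≡ true)
∨-true⇔ {true} = mk⇔ inj₁ (λ _ → refl)
∨-true⇔ {false} = mk⇔ inj₂ λ { (inj₁ ()) ; (inj₂ e) → e }

module _ {d : ℕ} (i : Fin (suc (suc d))) where

  toℕ≤1+d : toℕ i ≤ suc d
  toℕ≤1+d = ≤-pred (toℕ<n i)

  pathAdj-true⇔ : ∀ (j : Fin (suc (suc d))) →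
    pathAdj i j ≡ true ⇔ (suc (toℕ i) ≡ toℕ j ⊎ suc (toℕ j) ≡ toℕ i)
  pathAdj-true⇔ j = ⇔-trans ∨-true⇔ (≡ᵇ-true⇔ ⊎-⇔ ≡ᵇ-true⇔)

  inner-true⇔ : inner i ≡ true ⇔ (1 ≤ toℕ i × toℕ i ≤ d)
  inner-true⇔ = mk⇔
    (λ e → let (p , q) = Equivalence.to ∧-true⇔ e in
           Equivalence.to ≤ᵇ-true⇔ p , Equivalence.to ≤ᵇ-true⇔ q)
    (λ (p , q) → Equivalence.from ∧-true⇔ (Equivalence.from ≤ᵇ-true⇔ p , Equivalence.from ≤ᵇ-true⇔ q))

  innerOrL-true⇔ : (inner i ∨ isL i) ≡ true ⇔ toℕ i ≤ d
  innerOrL-true⇔ = mk⇔ to from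
    where
    to : (inner i ∨ isL i) ≡ true → toℕ i ≤ d
    to e with Equivalence.to ∨-true⇔ e
    ... | inj₁ p = proj₂ (Equivalence.to inner-true⇔ p)
    ... | inj₂ p = subst (_≤ d) (sym (Equivalence.to ≡ᵇ-true⇔ p)) z≤n
    from : toℕ i ≤ d → (inner i ∨ isL i) ≡ true
    from le with toℕ i ≟ 0
    ... | yes e = Equivalence.from ∨-true⇔ (inj₂ (Equivalence.from ≡ᵇ-true⇔ e))
    ... | no ne = Equivalence.from ∨-true⇔ (inj₁ (Equivalence.from inner-true⇔ (n≢0⇒n>0 ne , le)))

  innerOrR-true⇔ : (inner i ∨ isR i) ≡ true ⇔ 1 ≤ toℕ i
  innerOrR-true⇔ = mk⇔ to from
    where
    to : (inner i ∨ isR i) ≡ true → 1 ≤ toℕ i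
    to e with Equivalence.to ∨-true⇔ e
    ... | inj₁ p = proj₁ (Equivalence.to inner-true⇔ p)
    ... | inj₂ p = subst (1 ≤_) (sym (Equivalence.to ≡ᵇ-true⇔ p)) (s≤s z≤n)
    from : 1 ≤ toℕ i → (inner i ∨ isR i) ≡ true
    from le with toℕ i ≟ suc d
    ... | yes e = Equivalence.from ∨-true⇔ (inj₂ (Equivalence.from ≡ᵇ-true⇔ e))
    ... | no ne = Equivalence.from ∨-true⇔
                    (inj₁ (Equivalence.from inner-true⇔ (le , ≤-pred (≤∧≢⇒< toℕ≤1+d ne))))

¬¬-∀-Subset : ∀ {m} (P : Subset m → Set) → (∀ X → ¬ ¬ P X) → ¬ ¬ (∀ X → P X)
¬¬-∀-Subset {zero} P h k = h [] (λ p → k (λ { [] → p }))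
¬¬-∀-Subset {suc m} P h k =
  ¬¬-∀-Subset (λ X → P (inside ∷ X)) (λ X → h (inside ∷ X)) λ pin →
  ¬¬-∀-Subset (λ X → P (outside ∷ X)) (λ X → h (outside ∷ X)) λ pout →
  k (λ { (inside ∷ X) → pin X ; (outside ∷ X) → pout X })

Fin-∀⊎ : ∀ {m} {A : Fin m → Set} {B : Set} → (∀ x → A x ⊎ B) → (∀ x → A x) ⊎ B
Fin-∀⊎ {zero} f = inj₁ (λ ())
Fin-∀⊎ {suc m} {A} f with f fzero | Fin-∀⊎ {A = A ∘ fsuc} (f ∘ fsuc)
... | inj₂ b | _ = inj₂ b
... | inj₁ _ | inj₂ b = inj₂ b
... | inj₁ a | inj₁ as = inj₁ λ { fzero → a ; (fsuc x) → as x }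

last-failure : (P : ℕ → Set) → (∀ m → Dec (P m)) → ∀ k →
  (∀ m → m < k → P m) ⊎ (∃ λ m → m < k × ¬ P m × (∀ m' → m < m' → m' < k → P m'))
last-failure P P? zero = inj₁ (λ m ())
last-failure P P? (suc k) with P? k | last-failure P P? k
... | no ¬p | _ =
  inj₂ (k , ≤-refl , ¬p , λ m' k<m' m'≤k → ⊥-elim (<-irrefl refl (<-≤-trans k<m' (≤-pred m'≤k))))
... | yes p | inj₁ below =
  inj₁ λ m m≤k → [ below m , (λ { refl → p }) ]′ (m≤n⇒m<n∨m≡n (≤-pred m≤k))
... | yes p | inj₂ (m , m<k , ¬pm , between) =
  inj₂ (m , m<n⇒m<1+n m<k , ¬pm ,
        λ m' m<m' m'≤k → [ between m' m<m' , (λ { refl → p }) ]′ (m≤n⇒m<n∨m≡n (≤-pred m'≤k)))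

<⇒≡suc+ : ∀ {m k} → m < k → ∃ λ e → k ≡ suc (e + m)
<⇒≡suc+ {m} {suc k} (s≤s m≤k) = k ∸ m , cong suc (sym (m∸n+n≡m m≤k))

LastHit : (ℕ → Set) → ℕ → Set
LastHit Q k = (∀ m → m < k → ¬ Q m) ⊎ (∃ λ j → j < k × Q j × (∀ m → j < m → m < k → ¬ Q m))

last-hit : (Q : ℕ → Set) → (∀ m → Dec (Q m)) → ∀ k → LastHit Q k
last-hit Q Q? k with last-failure (¬_ ∘ Q) (¬? ∘ Q?) k
... | inj₁ none = inj₁ none
... | inj₂ (j , j<k , ¬¬Qj , after) = inj₂ (j , j<k , decidable-stable (Q? j) ¬¬Qj , after)

insert : ∀ {m} → Fin m → Subset m → Subset m
insert fzero (_ ∷ p) = inside ∷ p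
insert (fsuc x) (b ∷ p) = b ∷ insert x p

∣insert∣≤ : ∀ {m} (x : Fin m) (p : Subset m) → ∣ insert x p ∣ ≤ suc ∣ p ∣
∣insert∣≤ fzero (inside ∷ p) = n≤1+n _
∣insert∣≤ fzero (outside ∷ p) = ≤-refl
∣insert∣≤ (fsuc x) (inside ∷ p) = s≤s (∣insert∣≤ x p)
∣insert∣≤ (fsuc x) (outside ∷ p) = ∣insert∣≤ x p

x∈insert : ∀ {m} (x : Fin m) (p : Subset m) → x ∈ insert x p
x∈insert fzero (_ ∷ p) = here
x∈insert (fsuc x) (_ ∷ p) = there (x∈insert x p)

∈⇒∈insert : ∀ {m} (x : Fin m) {y} (p : Subset m) → y ∈ p → y ∈ insert x p
∈⇒∈insert fzero (_ ∷ p) here = here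
∈⇒∈insert fzero (_ ∷ p) (there q) = there q
∈⇒∈insert (fsuc x) (_ ∷ p) here = here
∈⇒∈insert (fsuc x) (_ ∷ p) (there q) = there (∈⇒∈insert x p q)

fromList : ∀ {m} → List (Fin m) → Subset m
fromList [] = ∅
fromList (x ∷ xs) = insert x (fromList xs)

∣fromList∣≤length : ∀ {m} (xs : List (Fin m)) → ∣ fromList xs ∣ ≤ length xs
∣fromList∣≤length {m} [] = ≤-reflexive (∣⊥∣≡0 m)
∣fromList∣≤length (x ∷ xs) = ≤-trans (∣insert∣≤ x (fromList xs)) (s≤s (∣fromList∣≤length xs))

∈ₗ⇒∈fromList : ∀ {m} {x : Fin m} (xs : List (Fin m)) → x ∈ₗ xs → x ∈ fromList xs
∈ₗ⇒∈fromList (y ∷ xs) (here′ refl) = x∈insert y (fromList xs)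
∈ₗ⇒∈fromList (y ∷ xs) (there′ p) = ∈⇒∈insert y (fromList xs) (∈ₗ⇒∈fromList xs p)


module _ (G : Graph) where

  private
    V : Set
    V = Fin (n G)

  adj-sym : ∀ {u v} → Adj G u v → Adj G v u
  adj-sym {u} {v} a = trans (Graph.sym G v u) a

  adj⇒≢ : ∀ {u v} → Adj G u v → u ≢ v
  adj⇒≢ {u} a refl with trans (sym a) (irrefl G u)
  ... | ()

  adj-nonadj⇒≢ : ∀ {u s v} → Adj G u s → ¬ Adj G s v → u ≢ v
  adj-nonadj⇒≢ us ¬sv refl = ¬sv (adj-sym us)

  Adj? : ∀ u v → Dec (Adj G u v)
  Adj? u v = adj G u v ≟ᵇ true

  adj-≡ : ∀ {u v b} {Q : Set} → Adj G u v ⇔ Q → b ≡ true ⇔ Q → adj G u v ≡ b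
  adj-≡ A B = ⇔→≡ (⇔-trans A (⇔-sym B))

  -- Interval-ness is not decidable, so a non-interval set yields a minimal one only under ¬¬.
  prereduced⇒¬¬interval : Prereduced G → ∀ k (X : Subset (n G)) → ∣ X ∣ ≤ k → k ≤ 10 →
    ¬ ¬ IsIntervalOn G X
  prereduced⇒¬¬interval pre k X ∣X∣≤k k≤10 ¬int =
    ¬¬-∀-Subset (λ Y → Y ⊂ X → IsIntervalOn G Y) proper
      (λ all → pre X (≤-trans ∣X∣≤k k≤10) (¬int , all))
    where
    proper : ∀ Y → ¬ ¬ (Y ⊂ X → IsIntervalOn G Y)
    proper Y ¬h = ¬h λ Y⊂X →
      ⊥-elim (by-size k ∣X∣≤k k≤10 (p⊂q⇒∣p∣<∣q∣ Y⊂X) (λ int → ¬h (λ _ → int)))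
      where
      by-size : ∀ k → ∣ X ∣ ≤ k → k ≤ 10 → ∣ Y ∣ < ∣ X ∣ → ¬ ¬ IsIntervalOn G Y
      by-size zero X≤0 _ Y<X = ⊥-elim (<⇒≱ (≤-trans Y<X X≤0) z≤n)
      by-size (suc k) X≤k k≤10 Y<X =
        prereduced⇒¬¬interval pre k Y (≤-pred (≤-trans Y<X X≤k)) (≤-trans (n≤1+n k) k≤10)

  Avoids : Subset (n G) → V → V → Set
  Avoids X z u = u ∈ X × u ≢ z × ¬ Adj G u z

  data Walk (Q : V → Set) : V → V → Set where
    stop : ∀ {u} → Q u → Walk Q u u
    step : ∀ {u v t} → Q u → Adj G u v → Walk Q v t → Walk Q u t

  first-ok : ∀ {Q u t} → Walk Q u t → Q u
  first-ok (stop q) = q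
  first-ok (step q _ _) = q

  last-ok : ∀ {Q u t} → Walk Q u t → Q t
  last-ok (stop q) = q
  last-ok (step _ _ w) = last-ok w

  snoc : ∀ {Q u t v} → Walk Q u t → Adj G t v → Q v → Walk Q u v
  snoc (stop q) a qv = step q a (stop qv)
  snoc (step q a w) a' qv = step q a (snoc w a' qv)

  reverse : ∀ {Q u t} → Walk Q u t → Walk Q t u
  reverse (stop q) = stop q
  reverse (step q a w) = snoc (reverse w) (adj-sym a) q

  module IntervalModel (X : Subset (n G)) (lo hi : V → ℕ)
      (lo≤hi : ∀ v → v ∈ X → lo v ≤ hi v)
      (adj⇔meet : ∀ u v → u ∈ X → v ∈ X → u ≢ v → (Adj G u v ⇔ (lo u ≤ hi v × lo v ≤ hi u))) where

    -- The first walk vertex whose interval is not left of m's meets m's interval, as its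
    -- predecessor's interval is left of m's.
    walk-cannot-jump : ∀ {m u t} → m ∈ X → Walk (Avoids X m) u t → hi u < lo m → hi m < lo t → ⊥
    walk-cannot-jump {m} {u} m∈X (stop (u∈X , _ , _)) u<m m<u =
      <-irrefl refl (<-≤-trans u<m (≤-trans (lo≤hi m m∈X) (≤-trans (<⇒≤ m<u) (lo≤hi u u∈X))))
    walk-cannot-jump {m} {u} m∈X (step {v = v} (u∈X , _ , _) uv w) u<m m<t with hi v <? lo m
    ... | yes v<m = walk-cannot-jump m∈X w v<m m<t
    ... | no v≮m =
      let (v∈X , v≢m , ¬vm) = first-ok w
          lo-v≤hi-u = proj₂ (Equivalence.to (adj⇔meet u v u∈X v∈X (adj⇒≢ uv)) uv)
      in ¬vm (Equivalence.from (adj⇔meet v m v∈X m∈X v≢m)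
               (≤-trans (≤-trans lo-v≤hi-u (<⇒≤ u<m)) (lo≤hi m m∈X) , ≮⇒≥ v≮m))

    nonadj⇒separated : ∀ u v → u ∈ X → v ∈ X → u ≢ v → ¬ Adj G u v → hi u < lo v ⊎ hi v < lo u
    nonadj⇒separated u v u∈X v∈X u≢v ¬uv with lo u ≤? hi v | lo v ≤? hi u
    ... | no p | _ = inj₂ (≰⇒> p)
    ... | yes _ | no q = inj₁ (≰⇒> q)
    ... | yes p | yes q = ⊥-elim (¬uv (Equivalence.from (adj⇔meet u v u∈X v∈X u≢v) (p , q)))

  interval⇒no-asteroidal-triple : ∀ (X : Subset (n G)) → IsIntervalOn G X → ∀ {x y z} →
    Walk (Avoids X z) x y → Walk (Avoids X x) y z → Walk (Avoids X y) x z → ⊥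
  interval⇒no-asteroidal-triple X (lo , hi , lo≤hi , adj⇔meet) {x} {y} {z} Wxy Wyz Wxz
    with first-ok Wxy | last-ok Wxy | first-ok Wyz | last-ok Wyz
  ... | x∈X , x≢z , ¬xz | y∈X , y≢z , ¬yz | _ , y≢x , ¬yx | z∈X , _ =
    by-order (separated x∈X y∈X (y≢x ∘ sym) (¬yx ∘ adj-sym)) (separated y∈X z∈X y≢z ¬yz)
             (separated x∈X z∈X x≢z ¬xz)
    where
    open IntervalModel X lo hi lo≤hi adj⇔meet
    separated : ∀ {u v} → u ∈ X → v ∈ X → u ≢ v → ¬ Adj G u v → hi u < lo v ⊎ hi v < lo u
    separated = nonadj⇒separated _ _
    by-order : hi x < lo y ⊎ hi y < lo x → hi y < lo z ⊎ hi z < lo y → hi x < lo z ⊎ hi z < lo x → ⊥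
    by-order (inj₁ xy) (inj₁ yz) _ = walk-cannot-jump y∈X Wxz xy yz
    by-order (inj₂ yx) (inj₂ zy) _ = walk-cannot-jump y∈X (reverse Wxz) zy yx
    by-order (inj₁ xy) (inj₂ zy) (inj₁ xz) = walk-cannot-jump z∈X Wxy xz zy
    by-order (inj₁ xy) (inj₂ zy) (inj₂ zx) = walk-cannot-jump x∈X (reverse Wyz) zx xy
    by-order (inj₂ yx) (inj₁ yz) (inj₁ xz) = walk-cannot-jump x∈X Wyz yx xz
    by-order (inj₂ yx) (inj₁ yz) (inj₂ zx) = walk-cannot-jump z∈X (reverse Wxy) yz zx

  record InducedPath (h : ℕ → V) (L : ℕ) : Set where
    field
      adjacent : ∀ i → i < L → Adj G (h i) (h (suc i))
      adj⇒consecutive : ∀ i j → i ≤ L → j ≤ L → Adj G (h i) (h j) → suc i ≡ j ⊎ suc j ≡ i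
      injective : ∀ i j → i ≤ L → j ≤ L → h i ≡ h j → i ≡ j

    nonconsecutive⇒nonadj : ∀ i j → i ≤ L → j ≤ L → suc i ≢ j → suc j ≢ i → ¬ Adj G (h i) (h j)
    nonconsecutive⇒nonadj i j i≤L j≤L ¬ij ¬ji a with adj⇒consecutive i j i≤L j≤L a
    ... | inj₁ e = ¬ij e
    ... | inj₂ e = ¬ji e

    distinct : ∀ i j → i ≤ L → j ≤ L → i ≢ j → h i ≢ h j
    distinct i j i≤L j≤L i≢j e = i≢j (injective i j i≤L j≤L e)

    adj⇔consecutive : ∀ i j → i ≤ L → j ≤ L → Adj G (h i) (h j) ⇔ (suc i ≡ j ⊎ suc j ≡ i)
    adj⇔consecutive i j i≤L j≤L = mk⇔ (adj⇒consecutive i j i≤L j≤L) λ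
      { (inj₁ refl) → adjacent i j≤L
      ; (inj₂ refl) → adj-sym (adjacent j i≤L) }

    far⇒distinct : ∀ i j → 2 + i ≤ j → j ≤ L → h i ≢ h j
    far⇒distinct i j i+2≤j j≤L = distinct i j (≤-trans (m≤n+m i 2) (≤-trans i+2≤j j≤L)) j≤L
      (<⇒≢ (≤-trans (s≤s (n≤1+n i)) i+2≤j))

    far⇒nonadj : ∀ i j → 2 + i ≤ j → j ≤ L → ¬ Adj G (h i) (h j)
    far⇒nonadj i j i+2≤j j≤L = nonconsecutive⇒nonadj i j (≤-trans (m≤n+m i 2) (≤-trans i+2≤j j≤L)) j≤L
      (<⇒≢ i+2≤j) (λ e → 1+n≰n (≤-trans (≤-reflexive e) (≤-trans (m≤n+m i 2) i+2≤j)))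

    walk-along : ∀ {Q} a b → a ≤ b → b ≤ L → (∀ t → a ≤ t → t ≤ b → Q (h t)) → Walk Q (h a) (h b)
    walk-along a b a≤b b≤L q with m≤n⇒m<n∨m≡n a≤b
    ... | inj₂ refl = stop (q a ≤-refl ≤-refl)
    walk-along a (suc b) a≤b b≤L q | inj₁ (s≤s a≤b') =
      snoc (walk-along a b a≤b' (≤-trans (n≤1+n b) b≤L) (λ t a≤t t≤b → q t a≤t (m≤n⇒m≤1+n t≤b)))
           (adjacent b b≤L) (q (suc b) a≤b ≤-refl)

  open InducedPath

  Detached : V → (ℕ → V) → ℕ → Set
  Detached s h L = ∀ t → t ≤ L → s ≢ h t × ¬ Adj G s (h t)

  truncate-path : ∀ {h L L'} → L' ≤ L → InducedPath h L → InducedPath h L'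
  truncate-path L'≤L P = record
    { adjacent = λ i i<L' → adjacent P i (<-≤-trans i<L' L'≤L)
    ; adj⇒consecutive = λ i j i≤ j≤ → adj⇒consecutive P i j (≤-trans i≤ L'≤L) (≤-trans j≤ L'≤L)
    ; injective = λ i j i≤ j≤ → injective P i j (≤-trans i≤ L'≤L) (≤-trans j≤ L'≤L) }

  shift-path : ∀ {h L} p L' → L' + p ≤ L → InducedPath h L → InducedPath (λ t → h (t + p)) L'
  shift-path {h} {L} p L' bound P = record
    { adjacent = λ i i<L' → adjacent P (i + p) (<-≤-trans (+-monoˡ-< p i<L') bound)
    ; adj⇒consecutive = λ i j i≤ j≤ a →
        Data.Sum.map (λ e → +-cancelʳ-≡ p (suc i) j e) (λ e → +-cancelʳ-≡ p (suc j) i e)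
          (adj⇒consecutive P (i + p) (j + p) (in-range i≤) (in-range j≤) a)
    ; injective = λ i j i≤ j≤ e →
        +-cancelʳ-≡ p i j (injective P (i + p) (j + p) (in-range i≤) (in-range j≤) e) }
    where
    in-range : ∀ {i} → i ≤ L' → i + p ≤ L
    in-range i≤L' = ≤-trans (+-monoˡ-≤ p i≤L') bound

  shift-detached : ∀ {s h L} p L' → L' + p ≤ L → Detached s h L → Detached s (λ t → h (t + p)) L'
  shift-detached p L' bound far t t≤L' = far (t + p) (≤-trans (+-monoˡ-≤ p t≤L') bound)

  ∸-step : ∀ L a b → a ≤ L → b ≤ L → L ∸ a ≡ suc (L ∸ b) → b ≡ suc a
  ∸-step L a b a≤L b≤L e = sym (+-cancelˡ-≡ (L ∸ b) _ _ (begin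
      (L ∸ b) + suc a ≡⟨ +-suc (L ∸ b) a ⟩
      suc (L ∸ b) + a ≡⟨ cong (_+ a) (sym e) ⟩
      (L ∸ a) + a     ≡⟨ m∸n+n≡m a≤L ⟩
      L               ≡⟨ sym (m∸n+n≡m b≤L) ⟩
      (L ∸ b) + b     ∎))
    where open ≡-Reasoning

  reverse-path : ∀ {h L} → InducedPath h L → InducedPath (λ t → h (L ∸ t)) L
  reverse-path {h} {L} P = record
    { adjacent = λ i i<L → subst (λ t → Adj G (h t) (h (L ∸ suc i))) (sym (+-∸-assoc 1 i<L))
                             (adj-sym (adjacent P (L ∸ suc i) (∸-monoʳ-< (s≤s z≤n) i<L)))
    ; adj⇒consecutive = λ i j i≤L j≤L a →
        Data.Sum.map (λ e → sym (∸-step L i j i≤L j≤L (sym e)))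
                     (λ e → sym (∸-step L j i j≤L i≤L (sym e)))
          (Data.Sum.swap (adj⇒consecutive P (L ∸ i) (L ∸ j) (m∸n≤m L i) (m∸n≤m L j) a))
    ; injective = λ i j i≤L j≤L e →
        ∸-cancelˡ-≡ i≤L j≤L (injective P (L ∸ i) (L ∸ j) (m∸n≤m L i) (m∸n≤m L j) e) }

  pathVertices : (ℕ → V) → ℕ → List V
  pathVertices h zero = h 0 ∷ []
  pathVertices h (suc L) = h (suc L) ∷ pathVertices h L

  length-pathVertices : ∀ h L → length (pathVertices h L) ≡ suc L
  length-pathVertices h zero = refl
  length-pathVertices h (suc L) = cong suc (length-pathVertices h L)

  ∈-pathVertices : ∀ h {t} L → t ≤ L → h t ∈ₗ pathVertices h L
  ∈-pathVertices h zero z≤n = here′ refl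
  ∈-pathVertices h {t} (suc L) t≤1+L with m≤n⇒m<n∨m≡n t≤1+L
  ... | inj₁ t<1+L = there′ (∈-pathVertices h L (≤-pred t<1+L))
  ... | inj₂ refl = here′ refl

  -- s, h 0 and h L form an asteroidal triple: x links s to h 0 and y links s to h L.
  bridged-path-¬interval : ∀ {s x y h L} j k → InducedPath h L → Detached s h L →
    Adj G x s → Adj G x (h j) → ¬ Adj G x (h L) → 2 + j ≤ L →
    Adj G y s → Adj G y (h k) → ¬ Adj G y (h 0) → 2 ≤ k → k ≤ L →
    ¬ IsIntervalOn G (fromList (s ∷ x ∷ y ∷ pathVertices h L))
  bridged-path-¬interval {s} {x} {y} {h} {L} j k P far xs xj ¬xL j+2≤L ys yk ¬y0 2≤k k≤L int =
    interval⇒no-asteroidal-triple X int s⇝0 0⇝L s⇝L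
    where
    vertices : List V
    vertices = s ∷ x ∷ y ∷ pathVertices h L
    X : Subset (n G)
    X = fromList vertices
    h∈X : ∀ t → t ≤ L → h t ∈ X
    h∈X t t≤L = ∈ₗ⇒∈fromList vertices (there′ (there′ (there′ (∈-pathVertices h L t≤L))))
    s⇝0 : Walk (Avoids X (h L)) s (h 0)
    s⇝0 = step (∈ₗ⇒∈fromList vertices (here′ refl) , far L ≤-refl) (adj-sym xs)
           (step (∈ₗ⇒∈fromList vertices (there′ (here′ refl)) ,
                  adj-nonadj⇒≢ xs (proj₂ (far L ≤-refl)) , ¬xL) xj
           (reverse (walk-along P 0 j z≤n (≤-trans (m≤n+m j 2) j+2≤L) λ t _ t≤j →
             let t+2≤L = ≤-trans (+-monoʳ-≤ 2 t≤j) j+2≤L in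
             h∈X t (≤-trans (m≤n+m t 2) t+2≤L) , far⇒distinct P t L t+2≤L ≤-refl ,
             far⇒nonadj P t L t+2≤L ≤-refl)))
    0⇝L : Walk (Avoids X s) (h 0) (h L)
    0⇝L = walk-along P 0 L z≤n ≤-refl λ t _ t≤L →
            h∈X t t≤L , (λ e → proj₁ (far t t≤L) (sym e)) , (λ a → proj₂ (far t t≤L) (adj-sym a))
    s⇝L : Walk (Avoids X (h 0)) s (h L)
    s⇝L = step (∈ₗ⇒∈fromList vertices (here′ refl) , far 0 z≤n) (adj-sym ys)
           (step (∈ₗ⇒∈fromList vertices (there′ (there′ (here′ refl))) ,
                  adj-nonadj⇒≢ ys (proj₂ (far 0 z≤n)) , ¬y0) yk
           (walk-along P k L k≤L ≤-refl λ t k≤t t≤L →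
             let 2≤t = ≤-trans 2≤k k≤t in
             h∈X t t≤L , (λ e → far⇒distinct P 0 t 2≤t t≤L (sym e)) ,
             (λ a → far⇒nonadj P 0 t 2≤t t≤L (adj-sym a))))

  prereduced⇒¬¬interval-bridged : Prereduced G → ∀ {s x y h} L → L ≤ 6 →
    ¬ ¬ IsIntervalOn G (fromList (s ∷ x ∷ y ∷ pathVertices h L))
  prereduced⇒¬¬interval-bridged pre {s} {x} {y} {h} L L≤6 =
    prereduced⇒¬¬interval pre 10 _
      (≤-trans (∣fromList∣≤length (s ∷ x ∷ y ∷ pathVertices h L))
               (subst (_≤ 10) (sym (cong (3 +_) (length-pathVertices h L))) (s≤s (s≤s (s≤s (s≤s L≤6))))))
      ≤-refl

  chordal⇒no-hole : Chordal G → ∀ {w h} L → 2 ≤ L → InducedPath h L → (∀ t → t ≤ L → w ≢ h t) →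
    Adj G w (h 0) → Adj G w (h L) → (∀ m → 0 < m → m < L → ¬ Adj G w (h m)) → ⊥
  chordal⇒no-hole chordal {w} {h} L@(suc (suc m)) (s≤s (s≤s z≤n)) P w∉P w0 wL ¬w-inner =
    no-chord (chordal m f f-injective f-cycle)
    where
    cycle : ℕ → V
    cycle zero = w
    cycle (suc t) = h t
    size≡ : m + 4 ≡ suc (suc L)
    size≡ = +-comm m 4
    Cyc : ℕ → ℕ → Set
    Cyc a b = (suc a ≡ b) ⊎ ((suc a ≡ suc (suc L)) × (b ≡ 0))
    f : Fin (m + 4) → V
    f k = cycle (toℕ k)
    bound : (k : Fin (m + 4)) → toℕ k ≤ suc L
    bound k = ≤-pred (subst (toℕ k <_) size≡ (toℕ<n k))
    toCyc : ∀ i j → Consec (m + 4) i j → Cyc (toℕ i) (toℕ j)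
    toCyc i j = subst (λ N → (suc (toℕ i) ≡ toℕ j) ⊎ ((suc (toℕ i) ≡ N) × (toℕ j ≡ 0))) size≡
    fromCyc : ∀ i j → Cyc (toℕ i) (toℕ j) → Consec (m + 4) i j
    fromCyc i j = subst (λ N → (suc (toℕ i) ≡ toℕ j) ⊎ ((suc (toℕ i) ≡ N) × (toℕ j ≡ 0))) (sym size≡)
    cycle-injective : ∀ a b → a ≤ suc L → b ≤ suc L → cycle a ≡ cycle b → a ≡ b
    cycle-injective zero zero _ _ _ = refl
    cycle-injective zero (suc b) _ b≤ e = ⊥-elim (w∉P b (≤-pred b≤) e)
    cycle-injective (suc a) zero a≤ _ e = ⊥-elim (w∉P a (≤-pred a≤) (sym e))
    cycle-injective (suc a) (suc b) a≤ b≤ e = cong suc (injective P a b (≤-pred a≤) (≤-pred b≤) e)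
    f-injective : ∀ {i j} → f i ≡ f j → i ≡ j
    f-injective {i} {j} e = toℕ-injective (cycle-injective (toℕ i) (toℕ j) (bound i) (bound j) e)
    cycle-edge : ∀ a b → b ≤ suc L → Cyc a b → Adj G (cycle a) (cycle b)
    cycle-edge zero .1 _ (inj₁ refl) = w0
    cycle-edge (suc a) .(suc (suc a)) b≤ (inj₁ refl) = adjacent P a (≤-pred b≤)
    cycle-edge .(suc L) .0 _ (inj₂ (refl , refl)) = adj-sym wL
    f-cycle : ∀ i j → Consec (m + 4) i j → Adj G (f i) (f j)
    f-cycle i j c = cycle-edge (toℕ i) (toℕ j) (bound j) (toCyc i j c)
    no-chord-at-w : ∀ b → b ≤ suc L → 0 ≢ b → ¬ Cyc 0 b → ¬ Cyc b 0 → ¬ Adj G w (cycle b)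
    no-chord-at-w zero _ 0≢0 _ _ _ = 0≢0 refl
    no-chord-at-w (suc zero) _ _ ¬c _ _ = ¬c (inj₁ refl)
    no-chord-at-w (suc (suc b)) b≤ _ _ ¬c a with suc b ≟ L
    ... | yes e = ¬c (inj₂ (cong (suc ∘ suc) e , refl))
    ... | no ne = ¬w-inner (suc b) (s≤s z≤n) (≤∧≢⇒< (≤-pred b≤) ne) a
    no-chord-between : ∀ a b → a ≤ suc L → b ≤ suc L → a ≢ b → ¬ Cyc a b → ¬ Cyc b a →
      ¬ Adj G (cycle a) (cycle b)
    no-chord-between zero b _ b≤ ne c₁ c₂ = no-chord-at-w b b≤ ne c₁ c₂
    no-chord-between (suc a) zero a≤ _ ne c₁ c₂ ad = no-chord-at-w (suc a) a≤ (ne ∘ sym) c₂ c₁ (adj-sym ad)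
    no-chord-between (suc a) (suc b) a≤ b≤ _ c₁ c₂ ad with adj⇒consecutive P a b (≤-pred a≤) (≤-pred b≤) ad
    ... | inj₁ e = c₁ (inj₁ (cong suc e))
    ... | inj₂ e = c₂ (inj₁ (cong suc e))
    no-chord : ¬ (∃ λ i → ∃ λ j → i ≢ j × ¬ Consec (m + 4) i j × ¬ Consec (m + 4) j i × Adj G (f i) (f j))
    no-chord (i , j , i≢j , c₁ , c₂ , ad) =
      no-chord-between (toℕ i) (toℕ j) (bound i) (bound j) (i≢j ∘ toℕ-injective)
        (c₁ ∘ fromCyc i j) (c₂ ∘ fromCyc j i) ad

  P₃ : V → V → V → ℕ → V
  P₃ a b c zero = a
  P₃ a b c (suc zero) = b
  P₃ a b c (suc (suc _)) = c

  P₃-induced : ∀ {a b c} → Adj G a b → Adj G b c → ¬ Adj G a c → a ≢ c → InducedPath (P₃ a b c) 2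
  P₃-induced {a} {b} {c} ab bc ¬ac a≢c = record
    { adjacent = λ { zero _ → ab ; (suc zero) _ → bc ; (suc (suc _)) (s≤s (s≤s ())) }
    ; adj⇒consecutive = consecutive
    ; injective = injective′ }
    where
    consecutive : ∀ i j → i ≤ 2 → j ≤ 2 → Adj G (P₃ a b c i) (P₃ a b c j) → suc i ≡ j ⊎ suc j ≡ i
    consecutive zero zero _ _ x = ⊥-elim (adj⇒≢ x refl)
    consecutive zero (suc zero) _ _ _ = inj₁ refl
    consecutive zero (suc (suc zero)) _ _ x = ⊥-elim (¬ac x)
    consecutive (suc zero) zero _ _ _ = inj₂ refl
    consecutive (suc zero) (suc zero) _ _ x = ⊥-elim (adj⇒≢ x refl)
    consecutive (suc zero) (suc (suc zero)) _ _ _ = inj₁ refl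
    consecutive (suc (suc zero)) zero _ _ x = ⊥-elim (¬ac (adj-sym x))
    consecutive (suc (suc zero)) (suc zero) _ _ _ = inj₂ refl
    consecutive (suc (suc zero)) (suc (suc zero)) _ _ x = ⊥-elim (adj⇒≢ x refl)
    consecutive (suc (suc (suc _))) _ (s≤s (s≤s ())) _ _
    consecutive _ (suc (suc (suc _))) _ (s≤s (s≤s ())) _
    injective′ : ∀ i j → i ≤ 2 → j ≤ 2 → P₃ a b c i ≡ P₃ a b c j → i ≡ j
    injective′ zero zero _ _ _ = refl
    injective′ zero (suc zero) _ _ e = ⊥-elim (adj⇒≢ ab e)
    injective′ zero (suc (suc zero)) _ _ e = ⊥-elim (a≢c e)
    injective′ (suc zero) zero _ _ e = ⊥-elim (adj⇒≢ ab (sym e))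
    injective′ (suc zero) (suc zero) _ _ _ = refl
    injective′ (suc zero) (suc (suc zero)) _ _ e = ⊥-elim (adj⇒≢ bc e)
    injective′ (suc (suc zero)) zero _ _ e = ⊥-elim (a≢c (sym e))
    injective′ (suc (suc zero)) (suc zero) _ _ e = ⊥-elim (adj⇒≢ bc (sym e))
    injective′ (suc (suc zero)) (suc (suc zero)) _ _ _ = refl
    injective′ (suc (suc (suc _))) _ (s≤s (s≤s ())) _ _
    injective′ _ (suc (suc (suc _))) _ (s≤s (s≤s ())) _

  ShallowTerminalOfAW : V → ℕ → Set
  ShallowTerminalOfAW s d = (Σ (AWV 1 d → V) λ φ → DaggerAW G d φ × φ shallow ≡ s)
                          ⊎ (Σ (AWV 2 d → V) λ φ → DDaggerAW G d φ × φ shallow ≡ s)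

  base-injective : ∀ {k d} {i j : Fin (suc (suc d))} → toℕ i ≡ toℕ j → _≡_ {A = AWV k d} (base i) (base j)
  base-injective e = cong base (toℕ-injective e)

  path-adj-≡ : ∀ {d g} → InducedPath g (suc d) → ∀ i j → adj G (g (toℕ i)) (g (toℕ j)) ≡ pathAdj i j
  path-adj-≡ P i j = adj-≡ (adj⇔consecutive P _ _ (toℕ≤1+d i) (toℕ≤1+d j)) (pathAdj-true⇔ i j)

  inner-of-ends : ∀ {d} {Q : ℕ → Set} t → t ≤ suc d → ¬ Q 0 → ¬ Q (suc d) → Q t → 1 ≤ t × t ≤ d
  inner-of-ends zero _ ¬Q0 _ q = ⊥-elim (¬Q0 q)
  inner-of-ends {d} (suc t) t≤ _ ¬Qd q with suc t ≟ suc d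
  ... | yes refl = ⊥-elim (¬Qd q)
  ... | no ne = s≤s z≤n , ≤-pred (≤∧≢⇒< t≤ ne)

  dagger-from-path : ∀ d → 3 ≤ d → ∀ {s c g} → InducedPath g (suc d) → Detached s g (suc d) →
    Adj G c s → (∀ i → 1 ≤ i → i ≤ d → Adj G c (g i)) → ¬ Adj G c (g 0) → ¬ Adj G c (g (suc d)) →
    ShallowTerminalOfAW s d
  dagger-from-path d 3≤d {s} {c} {g} P far cs c-inner ¬c0 ¬cR = inj₁ (φ , (3≤d , injective′ , adj-φ) , refl)
    where
    φ : AWV 1 d → V
    φ shallow = s
    φ (centre _) = c
    φ (base i) = g (toℕ i)
    c∉P : ∀ t → t ≤ suc d → c ≢ g t
    c∉P t t≤ = adj-nonadj⇒≢ cs (proj₂ (far t t≤))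
    injective′ : ∀ {x y} → φ x ≡ φ y → x ≡ y
    injective′ {shallow} {shallow} e = refl
    injective′ {shallow} {centre _} e = ⊥-elim (adj⇒≢ cs (sym e))
    injective′ {shallow} {base j} e = ⊥-elim (proj₁ (far _ (toℕ≤1+d j)) e)
    injective′ {centre _} {shallow} e = ⊥-elim (adj⇒≢ cs e)
    injective′ {centre fzero} {centre fzero} e = refl
    injective′ {centre _} {base j} e = ⊥-elim (c∉P _ (toℕ≤1+d j) e)
    injective′ {base i} {shallow} e = ⊥-elim (proj₁ (far _ (toℕ≤1+d i)) (sym e))
    injective′ {base i} {centre _} e = ⊥-elim (c∉P _ (toℕ≤1+d i) (sym e))
    injective′ {base i} {base j} e = base-injective (injective P _ _ (toℕ≤1+d i) (toℕ≤1+d j) e)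
    c-base : ∀ i → adj G c (g (toℕ i)) ≡ inner i
    c-base i = adj-≡ (mk⇔ (inner-of-ends {Q = λ t → Adj G c (g t)} (toℕ i) (toℕ≤1+d i) ¬c0 ¬cR)
                          (λ (p , q) → c-inner _ p q))
                     (inner-true⇔ i)
    adj-φ : ∀ x y → adj G (φ x) (φ y) ≡ daggerAdj d x y
    adj-φ shallow shallow = irrefl G s
    adj-φ shallow (centre _) = adj-sym cs
    adj-φ shallow (base j) = ¬-not (proj₂ (far _ (toℕ≤1+d j)))
    adj-φ (centre _) shallow = cs
    adj-φ (centre _) (centre _) = irrefl G c
    adj-φ (centre _) (base j) = c-base j
    adj-φ (base i) shallow = ¬-not (proj₂ (far _ (toℕ≤1+d i)) ∘ adj-sym)
    adj-φ (base i) (centre _) = trans (Graph.sym G _ _) (c-base i)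
    adj-φ (base i) (base j) = path-adj-≡ P i j

  ddagger-from-path : ∀ d → 2 ≤ d → ∀ {s c₁ c₂ g} → InducedPath g (suc d) → Detached s g (suc d) →
    Adj G c₁ s → Adj G c₂ s → Adj G c₁ c₂ →
    (∀ i → i ≤ d → Adj G c₁ (g i)) → ¬ Adj G c₁ (g (suc d)) →
    (∀ i → 1 ≤ i → i ≤ suc d → Adj G c₂ (g i)) → ¬ Adj G c₂ (g 0) →
    ShallowTerminalOfAW s d
  ddagger-from-path d 2≤d {s} {c₁} {c₂} {g} P far c₁s c₂s c₁c₂ c₁-left ¬c₁R c₂-right ¬c₂0 =
    inj₂ (φ , (2≤d , injective′ , adj-φ) , refl)
    where
    φ : AWV 2 d → V
    φ shallow = s
    φ (centre fzero) = c₁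
    φ (centre (fsuc _)) = c₂
    φ (base i) = g (toℕ i)
    c∉P : ∀ {c} t → t ≤ suc d → Adj G c s → c ≢ g t
    c∉P t t≤ cs = adj-nonadj⇒≢ cs (proj₂ (far t t≤))
    injective′ : ∀ {x y} → φ x ≡ φ y → x ≡ y
    injective′ {shallow} {shallow} e = refl
    injective′ {shallow} {centre fzero} e = ⊥-elim (adj⇒≢ c₁s (sym e))
    injective′ {shallow} {centre (fsuc _)} e = ⊥-elim (adj⇒≢ c₂s (sym e))
    injective′ {shallow} {base j} e = ⊥-elim (proj₁ (far _ (toℕ≤1+d j)) e)
    injective′ {centre fzero} {shallow} e = ⊥-elim (adj⇒≢ c₁s e)
    injective′ {centre (fsuc _)} {shallow} e = ⊥-elim (adj⇒≢ c₂s e)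
    injective′ {centre fzero} {centre fzero} e = refl
    injective′ {centre fzero} {centre (fsuc _)} e = ⊥-elim (adj⇒≢ c₁c₂ e)
    injective′ {centre (fsuc _)} {centre fzero} e = ⊥-elim (adj⇒≢ c₁c₂ (sym e))
    injective′ {centre (fsuc fzero)} {centre (fsuc fzero)} e = refl
    injective′ {centre fzero} {base j} e = ⊥-elim (c∉P _ (toℕ≤1+d j) c₁s e)
    injective′ {centre (fsuc _)} {base j} e = ⊥-elim (c∉P _ (toℕ≤1+d j) c₂s e)
    injective′ {base i} {shallow} e = ⊥-elim (proj₁ (far _ (toℕ≤1+d i)) (sym e))
    injective′ {base i} {centre fzero} e = ⊥-elim (c∉P _ (toℕ≤1+d i) c₁s (sym e))
    injective′ {base i} {centre (fsuc _)} e = ⊥-elim (c∉P _ (toℕ≤1+d i) c₂s (sym e))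
    injective′ {base i} {base j} e = base-injective (injective P _ _ (toℕ≤1+d i) (toℕ≤1+d j) e)
    c₁-base : ∀ i → adj G c₁ (g (toℕ i)) ≡ (inner i ∨ isL i)
    c₁-base i = adj-≡ (mk⇔ (λ a → ≤-pred (≤∧≢⇒< (toℕ≤1+d i)
                                λ e → ¬c₁R (subst (λ t → Adj G c₁ (g t)) e a)))
                           (c₁-left _))
                      (innerOrL-true⇔ i)
    c₂-base : ∀ i → adj G c₂ (g (toℕ i)) ≡ (inner i ∨ isR i)
    c₂-base i = adj-≡ (mk⇔ (λ a → ≤∧≢⇒< z≤n λ e → ¬c₂0 (subst (λ t → Adj G c₂ (g t)) (sym e) a))
                           (λ 1≤i → c₂-right _ 1≤i (toℕ≤1+d i)))
                      (innerOrR-true⇔ i)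
    adj-φ : ∀ x y → adj G (φ x) (φ y) ≡ ddaggerAdj d x y
    adj-φ shallow shallow = irrefl G s
    adj-φ shallow (centre fzero) = adj-sym c₁s
    adj-φ shallow (centre (fsuc fzero)) = adj-sym c₂s
    adj-φ shallow (base j) = ¬-not (proj₂ (far _ (toℕ≤1+d j)))
    adj-φ (centre fzero) shallow = c₁s
    adj-φ (centre (fsuc fzero)) shallow = c₂s
    adj-φ (centre fzero) (centre fzero) = irrefl G c₁
    adj-φ (centre fzero) (centre (fsuc fzero)) = c₁c₂
    adj-φ (centre (fsuc fzero)) (centre fzero) = adj-sym c₁c₂
    adj-φ (centre (fsuc fzero)) (centre (fsuc fzero)) = irrefl G c₂
    adj-φ (centre fzero) (base j) = c₁-base j
    adj-φ (centre (fsuc fzero)) (base j) = c₂-base j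
    adj-φ (base i) shallow = ¬-not (proj₂ (far _ (toℕ≤1+d i)) ∘ adj-sym)
    adj-φ (base i) (centre fzero) = trans (Graph.sym G _ _) (c₁-base i)
    adj-φ (base i) (centre (fsuc fzero)) = trans (Graph.sym G _ _) (c₂-base i)
    adj-φ (base i) (base j) = path-adj-≡ P i j

  HasSmallerAW : V → ℕ → Set
  HasSmallerAW s d = ∃ λ d′ → d′ < d × ShallowTerminalOfAW s d′

  module LeftCentred (pre : Prereduced G) (chordal : Chordal G) {d : ℕ} (2≤d : 2 ≤ d) {s w : V} {g : ℕ → V}
      (P : InducedPath g (suc d)) (far : Detached s g (suc d)) (ws : Adj G w s)
      {C : V} {D : ℕ} (3≤D : 3 ≤ D) (d≤D : d ≤ D) (Cs : Adj G C s) (Cw : Adj G C w)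
      (¬C0 : ¬ Adj G C (g 0)) (C-right : ∀ i → 1 ≤ i → i ≤ D → Adj G C (g i)) (w≢C : w ≢ C) where

    w∉P : ∀ t → t ≤ suc d → w ≢ g t
    w∉P t t≤ = adj-nonadj⇒≢ ws (proj₂ (far t t≤))

    no-bridge : ∀ {x y} p L j k → L + p ≤ suc d → L ≤ 6 →
      Adj G x s → Adj G x (g (j + p)) → ¬ Adj G x (g (L + p)) → 2 + j ≤ L →
      Adj G y s → Adj G y (g (k + p)) → ¬ Adj G y (g p) → 2 ≤ k → k ≤ L → ⊥
    no-bridge p L j k bound L≤6 xs xj ¬xL j+2≤L ys yk ¬y0 2≤k k≤L =
      prereduced⇒¬¬interval-bridged pre L L≤6
        (bridged-path-¬interval j k (shift-path p L bound P) (shift-detached p L bound far)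
           xs xj ¬xL j+2≤L ys yk ¬y0 2≤k k≤L)

    no-bridge-via-C : Adj G w (g 1) → ¬ Adj G w (g 3) → ⊥
    no-bridge-via-C w1 ¬w3 =
      no-bridge 0 3 1 3 (s≤s 2≤d) (≤ᵇ⇒≤ 3 6 _) ws w1 ¬w3 ≤-refl
        Cs (C-right 3 (s≤s z≤n) 3≤D) ¬C0 (≤ᵇ⇒≤ 2 3 _) ≤-refl

    isolated-neighbour : ∀ p → 4 + p ≤ suc d →
      Adj G w (g (2 + p)) → ¬ Adj G w (g p) → ¬ Adj G w (g (4 + p)) → ⊥
    isolated-neighbour p bound w2 ¬w0 ¬w4 =
      no-bridge p 4 2 2 bound (≤ᵇ⇒≤ 4 6 _) ws w2 ¬w4 ≤-refl ws w2 ¬w0 ≤-refl (≤ᵇ⇒≤ 2 4 _)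

    gap-extends-left : ∀ p → 2 + p ≤ suc d → ¬ Adj G w (g (suc p)) → Adj G w (g (2 + p)) → ¬ Adj G w (g p)
    gap-extends-left p bound ¬w1 w2 w0 =
      chordal⇒no-hole chordal 2 ≤-refl (shift-path p 2 bound P)
        (λ t t≤2 → w∉P (t + p) (≤-trans (+-monoˡ-≤ p t≤2) bound)) w0 w2
        λ { (suc zero) _ _ → ¬w1 ; (suc (suc _)) _ (s≤s (s≤s ())) }

    run-from-start : ∀ k → k < d → Adj G w (g k) → (∀ m → k < m → m ≤ suc d → ¬ Adj G w (g m)) →
      (∀ m → m < k → Adj G w (g m)) → HasSmallerAW s d
    run-from-start zero _ w0 after _ = ⊥-elim (chordal⇒no-hole chordal 2 ≤-refl
      (P₃-induced (adjacent P 0 (s≤s z≤n)) (adj-sym (C-right 1 ≤-refl (≤-trans (s≤s z≤n) 3≤D)))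
         (¬C0 ∘ adj-sym) (λ e → adj-nonadj⇒≢ Cs (proj₂ (far 0 z≤n)) (sym e)))
      (λ { zero _ → w∉P 0 z≤n ; (suc zero) _ → w∉P 1 (s≤s z≤n) ; (suc (suc _)) _ → w≢C })
      w0 (adj-sym Cw)
      λ { (suc zero) _ _ → after 1 ≤-refl (s≤s z≤n) ; (suc (suc _)) _ (s≤s (s≤s ())) })
    run-from-start (suc zero) _ w1 after _ =
      ⊥-elim (no-bridge-via-C w1 (after 3 (≤ᵇ⇒≤ 2 3 _) (s≤s 2≤d)))
    run-from-start k@(suc (suc _)) k<d wk after below =
      k , k<d , ddagger-from-path k (s≤s (s≤s z≤n)) (truncate-path 1+k≤1+d P)
        (λ t t≤ → far t (≤-trans t≤ 1+k≤1+d)) ws Cs (adj-sym Cw)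
        (λ t t≤k → [ below t , (λ { refl → wk }) ]′ (m≤n⇒m<n∨m≡n t≤k)) (after (suc k) ≤-refl 1+k≤1+d)
        (λ t 1≤t t≤ → C-right t 1≤t (≤-trans t≤ (≤-trans k<d d≤D))) ¬C0
      where
      1+k≤1+d : suc k ≤ suc d
      1+k≤1+d = ≤-trans k<d (n≤1+n d)

    run-after-gap : ∀ e m → suc (e + m) < d → Adj G w (g (suc (e + m))) →
      (∀ m′ → suc (e + m) < m′ → m′ ≤ suc d → ¬ Adj G w (g m′)) → ¬ Adj G w (g m) →
      (∀ m′ → m < m′ → m′ < suc (e + m) → Adj G w (g m′)) → HasSmallerAW s d
    run-after-gap zero zero _ w1 after _ _ =
      ⊥-elim (no-bridge-via-C w1 (after 3 (≤ᵇ⇒≤ 2 3 _) (s≤s 2≤d)))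
    run-after-gap zero (suc p) k<d w2 after ¬w1 _ =
      ⊥-elim (isolated-neighbour p (s≤s k<d) w2
        (gap-extends-left p (≤-trans (n≤1+n _) (≤-trans (n≤1+n _) (s≤s k<d))) ¬w1 w2)
        (after (4 + p) (n≤1+n _) (s≤s k<d)))
    run-after-gap (suc zero) m k<d w2 after ¬w0 _ =
      ⊥-elim (isolated-neighbour m (s≤s k<d) w2 ¬w0 (after (4 + m) (n≤1+n _) (s≤s k<d)))
    run-after-gap e@(suc (suc _)) m k<d wk after ¬wm between =
      suc e , ≤-trans (s≤s (s≤s (m≤m+n e m))) k<d ,
      dagger-from-path (suc e) (s≤s (s≤s (s≤s z≤n))) (shift-path m (suc (suc e)) bound P)
        (shift-detached m (suc (suc e)) bound far) ws w-inner ¬wm (after (suc (suc (e + m))) ≤-refl bound)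
      where
      bound : suc (suc e) + m ≤ suc d
      bound = ≤-trans k<d (n≤1+n d)
      w-inner : ∀ t → 1 ≤ t → t ≤ suc e → Adj G w (g (t + m))
      w-inner t 1≤t t≤ with m≤n⇒m<n∨m≡n (+-monoˡ-≤ m t≤)
      ... | inj₁ lt = between (t + m) (+-monoˡ-≤ m 1≤t) lt
      ... | inj₂ eq = subst (λ x → Adj G w (g x)) (sym eq) wk

    last-neighbour⇒smaller : ∀ k → k < d → Adj G w (g k) →
      (∀ m → k < m → m ≤ suc d → ¬ Adj G w (g m)) → HasSmallerAW s d
    last-neighbour⇒smaller k k<d wk after with last-failure (Adj G w ∘ g) (Adj? w ∘ g) k
    ... | inj₁ below = run-from-start k k<d wk after below
    ... | inj₂ (m , m<k , ¬wm , between) with <⇒≡suc+ m<k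
    ...   | e , refl = run-after-gap e m k<d wk after ¬wm between

  module TwoCentred (pre : Prereduced G) (chordal : Chordal G) {d : ℕ} (2≤d : 2 ≤ d) {s w : V} {g : ℕ → V}
      (P : InducedPath g (suc d)) (far : Detached s g (suc d)) (ws : Adj G w s)
      {CL : V} {DL : ℕ} (3≤DL : 3 ≤ DL) (d≤DL : d ≤ DL) (CLs : Adj G CL s) (CLw : Adj G CL w)
      (¬CL0 : ¬ Adj G CL (g 0)) (CL-right : ∀ i → 1 ≤ i → i ≤ DL → Adj G CL (g i)) (w≢CL : w ≢ CL)
      {CR : V} {DR : ℕ} (3≤DR : 3 ≤ DR) (d≤DR : d ≤ DR) (CRs : Adj G CR s) (CRw : Adj G CR w)
      (¬CRL : ¬ Adj G CR (g (suc d ∸ 0))) (CR-left : ∀ i → 1 ≤ i → i ≤ DR → Adj G CR (g (suc d ∸ i)))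
      (w≢CR : w ≢ CR) where

    private
      L : ℕ
      L = suc d

    module FromLeft = LeftCentred pre chordal 2≤d P far ws 3≤DL d≤DL CLs CLw ¬CL0 CL-right w≢CL
    module FromRight = LeftCentred pre chordal 2≤d (reverse-path P) (λ t _ → far (L ∸ t) (m∸n≤m L t))
                         ws 3≤DR d≤DR CRs CRw ¬CRL CR-left w≢CR

    mirror : ∀ {t} → t ≤ L → ¬ Adj G w (g (L ∸ (L ∸ t))) → ¬ Adj G w (g t)
    mirror t≤L = subst (λ x → ¬ Adj G w (g x)) (m∸[m∸n]≡n t≤L)

    nonneighbour⇒detached-or-smaller : ∀ i → 1 ≤ i → i ≤ d → ¬ Adj G w (g i) →
      (∀ t → t ≤ L → ¬ Adj G w (g t)) ⊎ HasSmallerAW s d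
    nonneighbour⇒detached-or-smaller i 1≤i i≤d ¬wi =
      by-sides (last-hit (Adj G w ∘ g) (Adj? w ∘ g) i)
               (last-hit (λ m → Adj G w (g (L ∸ m))) (λ m → Adj? w (g (L ∸ m))) (L ∸ i))
      where
      i≤L : i ≤ L
      i≤L = ≤-trans i≤d (n≤1+n d)
      L∸i≤d : L ∸ i ≤ d
      L∸i≤d = ∸-monoʳ-≤ L 1≤i
      by-sides : LastHit (Adj G w ∘ g) i → LastHit (λ m → Adj G w (g (L ∸ m))) (L ∸ i) →
                 (∀ t → t ≤ L → ¬ Adj G w (g t)) ⊎ HasSmallerAW s d
      by-sides (inj₁ none-left) (inj₁ none-right) = inj₁ none
        where
        none : ∀ t → t ≤ L → ¬ Adj G w (g t)
        none t t≤L with <-cmp t i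
        ... | tri< t<i _ _ = none-left t t<i
        ... | tri≈ _ refl _ = ¬wi
        ... | tri> _ _ i<t = mirror t≤L (none-right (L ∸ t) (∸-monoʳ-< i<t t≤L))
      by-sides (inj₂ (j , j<i , wj , left-gap)) (inj₁ none-right) =
        inj₂ (FromLeft.last-neighbour⇒smaller j (<-≤-trans j<i i≤d) wj after)
        where
        after : ∀ m → j < m → m ≤ L → ¬ Adj G w (g m)
        after m j<m m≤L with <-cmp m i
        ... | tri< m<i _ _ = left-gap m j<m m<i
        ... | tri≈ _ refl _ = ¬wi
        ... | tri> _ _ i<m = mirror m≤L (none-right (L ∸ m) (∸-monoʳ-< i<m m≤L))
      by-sides (inj₁ none-left) (inj₂ (k′ , k′<L∸i , wk′ , right-gap)) =
        inj₂ (FromRight.last-neighbour⇒smaller k′ (<-≤-trans k′<L∸i L∸i≤d) wk′ after)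
        where
        after : ∀ m → k′ < m → m ≤ L → ¬ Adj G w (g (L ∸ m))
        after m k′<m m≤L with <-cmp m (L ∸ i)
        ... | tri< m<L∸i _ _ = right-gap m k′<m m<L∸i
        ... | tri≈ _ refl _ = subst (λ x → ¬ Adj G w (g x)) (sym (m∸[m∸n]≡n i≤L)) ¬wi
        ... | tri> _ _ L∸i<m = none-left (L ∸ m) (subst (L ∸ m <_) (m∸[m∸n]≡n i≤L) (∸-monoʳ-< L∸i<m m≤L))
      by-sides (inj₂ (j , j<i , wj , left-gap)) (inj₂ (k′ , k′<L∸i , wk , right-gap)) =
        ⊥-elim (chordal⇒no-hole chordal (k ∸ j) 2≤k∸j (shift-path j (k ∸ j) bound P)
                  (λ t t≤ → adj-nonadj⇒≢ ws (proj₂ (far (t + j) (≤-trans (+-monoˡ-≤ j t≤) bound))))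
                  wj (subst (λ x → Adj G w (g x)) (sym (m∸n+n≡m j≤k)) wk) between)
        where
        k : ℕ
        k = L ∸ k′
        k′≤L : k′ ≤ L
        k′≤L = ≤-trans (<⇒≤ k′<L∸i) (m∸n≤m L i)
        i<k : i < k
        i<k = subst (_< k) (m∸[m∸n]≡n i≤L) (∸-monoʳ-< k′<L∸i (m∸n≤m L i))
        j≤k : j ≤ k
        j≤k = <⇒≤ (<-trans j<i i<k)
        bound : (k ∸ j) + j ≤ L
        bound = subst (_≤ L) (sym (m∸n+n≡m j≤k)) (m∸n≤m L k′)
        2≤k∸j : 2 ≤ k ∸ j
        2≤k∸j = subst (_≤ k ∸ j) (m+n∸n≡m 2 j) (∸-monoˡ-≤ j (≤-trans (s≤s j<i) i<k))
        between : ∀ m → 0 < m → m < k ∸ j → ¬ Adj G w (g (m + j))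
        between m 0<m m<k∸j with <-cmp (m + j) i
        ... | tri< lt _ _ = left-gap (m + j) (+-monoˡ-≤ j 0<m) lt
        ... | tri≈ _ eq _ = subst (λ x → ¬ Adj G w (g x)) (sym eq) ¬wi
        ... | tri> _ _ gt = mirror m+j≤L (right-gap (L ∸ (m + j)) k′< (∸-monoʳ-< gt m+j≤L))
          where
          m+j<k : m + j < k
          m+j<k = subst (m + j <_) (m∸n+n≡m j≤k) (+-monoˡ-< j m<k∸j)
          m+j≤L : m + j ≤ L
          m+j≤L = ≤-trans (<⇒≤ m+j<k) (m∸n≤m L k′)
          k′< : k′ < L ∸ (m + j)
          k′< = subst (_< L ∸ (m + j)) (m∸[m∸n]≡n k′≤L) (∸-monoʳ-< m+j<k (m∸n≤m L k′))

  module AWBasePath {k d : ℕ} {pat : AWV k d → AWV k d → Bool} {φ : AWV k d → V}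
      (copy : InducedCopy G pat φ)
      (pat-bases : ∀ i j → pat (base i) (base j) ≡ pathAdj i j)
      (pat-shallow-base : ∀ i → pat shallow (base i) ≡ false) where

    adj⇔pat : ∀ x y → Adj G (φ x) (φ y) ⇔ pat x y ≡ true
    adj⇔pat x y = mk⇔ (trans (sym (proj₂ copy x y))) (trans (proj₂ copy x y))

    -- out-of-range indices are sent to 0
    clamp : ℕ → Fin (suc (suc d))
    clamp t with t <? suc (suc d)
    ... | yes t<2+d = fromℕ< t<2+d
    ... | no _ = fzero

    toℕ-clamp : ∀ {t} → t ≤ suc d → toℕ (clamp t) ≡ t
    toℕ-clamp {t} t≤ with t <? suc (suc d)
    ... | yes t<2+d = toℕ-fromℕ< t<2+d
    ... | no t≮2+d = ⊥-elim (t≮2+d (s≤s t≤))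

    g : ℕ → V
    g t = φ (base (clamp t))

    g-toℕ : ∀ i → g (toℕ i) ≡ φ (base i)
    g-toℕ i = cong (φ ∘ base) (toℕ-injective (toℕ-clamp (toℕ≤1+d i)))

    adj-g⇔ : ∀ {R : ℕ → Set} (x : AWV k d) {t} → t ≤ suc d →
      (∀ i → pat x (base i) ≡ true ⇔ R (toℕ i)) → Adj G (φ x) (g t) ⇔ R t
    adj-g⇔ {R} x {t} t≤ pat⇔ =
      subst (λ u → Adj G (φ x) (g t) ⇔ R u) (toℕ-clamp t≤)
        (⇔-trans (adj⇔pat x (base (clamp t))) (pat⇔ (clamp t)))

    path : InducedPath g (suc d)
    path = record
      { adjacent = λ i i<1+d → Equivalence.from (consecutive i (suc i) (<⇒≤ i<1+d) i<1+d) (inj₁ refl)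
      ; adj⇒consecutive = λ i j i≤ j≤ → Equivalence.to (consecutive i j i≤ j≤)
      ; injective = λ i j i≤ j≤ e →
          trans (sym (toℕ-clamp i≤)) (trans (cong toℕ (base-inj (proj₁ copy e))) (toℕ-clamp j≤)) }
      where
      bases⇔ : ∀ a b → pat (base a) (base b) ≡ true ⇔ (suc (toℕ a) ≡ toℕ b ⊎ suc (toℕ b) ≡ toℕ a)
      bases⇔ a b rewrite pat-bases a b = pathAdj-true⇔ a b
      consecutive : ∀ i j → i ≤ suc d → j ≤ suc d → Adj G (g i) (g j) ⇔ (suc i ≡ j ⊎ suc j ≡ i)
      consecutive i j i≤ j≤ = subst₂ (λ a b → Adj G (g i) (g j) ⇔ (suc a ≡ b ⊎ suc b ≡ a))
        (toℕ-clamp i≤) (toℕ-clamp j≤)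
        (⇔-trans (adj⇔pat (base (clamp i)) (base (clamp j))) (bases⇔ (clamp i) (clamp j)))
      base-inj : ∀ {a b} → _≡_ {A = AWV k d} (base a) (base b) → a ≡ b
      base-inj refl = refl

    detached : Detached (φ shallow) g (suc d)
    detached t _ = (λ e → case proj₁ copy e of λ ())
                 , (λ a → case trans (sym (Equivalence.to (adj⇔pat shallow _) a)) (pat-shallow-base _) of λ ())

    missed-bases : ∀ {w} → (∀ t → t ≤ suc d → ¬ Adj G w (g t)) → ∀ i → ¬ Adj G w (φ (base i))
    missed-bases none i a = none (toℕ i) (toℕ≤1+d i) (subst (Adj G _) (sym (g-toℕ i)) a)

    neighbour-of-shallow∉bases : ∀ {w} → Adj G w (φ shallow) → ∀ i → w ≢ φ (base i)
    neighbour-of-shallow∉bases ws i e =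
      adj-nonadj⇒≢ ws (proj₂ (detached (toℕ i) (toℕ≤1+d i))) (trans e (sym (g-toℕ i)))

  replace-shallow : ∀ {k d} {pat : AWV k d → AWV k d → Bool} {φ : AWV k d → V} →
    InducedCopy G pat φ → ∀ w →
    pat shallow shallow ≡ false →
    (∀ c → pat shallow (centre c) ≡ true) → (∀ c → pat (centre c) shallow ≡ true) →
    (∀ i → pat shallow (base i) ≡ false) → (∀ i → pat (base i) shallow ≡ false) →
    (∀ c → Adj G w (φ (centre c))) → (∀ i → ¬ Adj G w (φ (base i))) →
    (∀ c → w ≢ φ (centre c)) → (∀ i → w ≢ φ (base i)) →
    Σ (AWV k d → V) λ φ′ → InducedCopy G pat φ′ × φ′ shallow ≡ w
  replace-shallow {k} {d} {pat} {φ} (injective′ , adj-φ) w ss sc cs sb bs wc ¬wb w≢c w≢b =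
    φ′ , (injective″ , adj-φ′) , refl
    where
    φ′ : AWV k d → V
    φ′ shallow = w
    φ′ x = φ x
    injective″ : ∀ {x y} → φ′ x ≡ φ′ y → x ≡ y
    injective″ {shallow} {shallow} e = refl
    injective″ {shallow} {centre c} e = ⊥-elim (w≢c c e)
    injective″ {shallow} {base i} e = ⊥-elim (w≢b i e)
    injective″ {centre c} {shallow} e = ⊥-elim (w≢c c (sym e))
    injective″ {base i} {shallow} e = ⊥-elim (w≢b i (sym e))
    injective″ {centre c} {centre c′} e = injective′ e
    injective″ {centre c} {base i} e = injective′ e
    injective″ {base i} {centre c} e = injective′ e
    injective″ {base i} {base j} e = injective′ e
    adj-φ′ : ∀ x y → adj G (φ′ x) (φ′ y) ≡ pat x y
    adj-φ′ shallow shallow = trans (irrefl G w) (sym ss)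
    adj-φ′ shallow (centre c) = trans (wc c) (sym (sc c))
    adj-φ′ shallow (base i) = trans (¬-not (¬wb i)) (sym (sb i))
    adj-φ′ (centre c) shallow = trans (adj-sym (wc c)) (sym (cs c))
    adj-φ′ (base i) shallow = trans (¬-not (¬wb i ∘ adj-sym)) (sym (bs i))
    adj-φ′ (centre c) (centre c′) = adj-φ _ _
    adj-φ′ (centre c) (base i) = adj-φ _ _
    adj-φ′ (base i) (centre c) = adj-φ _ _
    adj-φ′ (base i) (base j) = adj-φ _ _

  DominatingAW : V → Set
  DominatingAW s = (∃ λ (d : ℕ) → ∃ λ (φ : AWV 1 d → V) → DaggerAW G d φ × BasesDominate G φ s)
                 ⊎ (∃ λ (d : ℕ) → ∃ λ (φ : AWV 2 d → V) → DDaggerAW G d φ × BasesDominate G φ s)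

  bases-dominate-or-smaller : ∀ {k d} (φ : AWV k d → V) {s} →
    (∀ w i → Adj G s w → inner i ≡ true → ¬ Adj G (φ (base i)) w → ShallowTerminal G w ⊎ HasSmallerAW s d) →
    BasesDominate G φ s ⊎ HasSmallerAW s d
  bases-dominate-or-smaller {d = d} φ {s} reduce =
    Data.Sum.map₁ dominate (Fin-∀⊎ λ w → Fin-∀⊎ (check w))
    where
    Good : V → Fin (suc (suc d)) → Set
    Good w i = Adj G s w → inner i ≡ true → Adj G (φ (base i)) w ⊎ ShallowTerminal G w
    check : ∀ w i → Good w i ⊎ HasSmallerAW s d
    check w i with Adj? s w | inner i ≟ᵇ true | Adj? (φ (base i)) w
    ... | no ¬sw | _ | _ = inj₁ (λ sw _ → ⊥-elim (¬sw sw))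
    ... | yes _ | no ¬inner | _ = inj₁ (λ _ e → ⊥-elim (¬inner e))
    ... | yes _ | yes _ | yes bw = inj₁ (λ _ _ → inj₁ bw)
    ... | yes sw | yes inn | no ¬bw = Data.Sum.map₁ (λ st _ _ → inj₂ st) (reduce w i sw inn ¬bw)
    dominate : (∀ w i → Good w i) → BasesDominate G φ s
    dominate good i inn w sw ¬st with good w i sw inn
    ... | inj₁ bw = bw
    ... | inj₂ st = ⊥-elim (¬st st)

  module _ (pre : Prereduced G) (chordal : Chordal G) (simplicial : ∀ v → ShallowTerminal G v → Simplicial G v) where

    module _ {d : ℕ} {φ : AWV 1 d → V} (aw : DaggerAW G d φ) where

      open AWBasePath (proj₂ aw) (λ _ _ → refl) (λ _ → refl)

      private
        s c : V
        s = φ shallow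
        c = φ (centre fzero)
        cs : Adj G c s
        cs = Equivalence.from (adj⇔pat (centre fzero) shallow) refl
        c-g⇔ : ∀ {t} → t ≤ suc d → Adj G c (g t) ⇔ (1 ≤ t × t ≤ d)
        c-g⇔ t≤ = adj-g⇔ (centre fzero) t≤ inner-true⇔
        c-inner : ∀ t → 1 ≤ t → t ≤ d → Adj G c (g t)
        c-inner t 1≤t t≤d = Equivalence.from (c-g⇔ (≤-trans t≤d (n≤1+n d))) (1≤t , t≤d)

      dagger-reduces : ∀ w i → Adj G s w → inner i ≡ true → ¬ Adj G (φ (base i)) w →
        ShallowTerminal G w ⊎ HasSmallerAW s d
      dagger-reduces w i sw inn ¬bw with w ≟ᶠ c
      ... | yes refl = ⊥-elim (¬bw (Equivalence.from (adj⇔pat (base i) (centre fzero)) inn))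
      ... | no w≢c = Data.Sum.map₁ replace
          (Sides.nonneighbour⇒detached-or-smaller (toℕ i) (proj₁ i-inner) (proj₂ i-inner)
             (λ a → ¬bw (adj-sym (subst (Adj G w) (g-toℕ i) a))))
        where
        i-inner : 1 ≤ toℕ i × toℕ i ≤ d
        i-inner = Equivalence.to (inner-true⇔ i) inn
        cw : Adj G c w
        cw = simplicial s (inj₁ (d , φ , aw , refl)) c w (adj-sym cs) sw (w≢c ∘ sym)
        module Sides = TwoCentred pre chordal (≤-trans (n≤1+n 2) (proj₁ aw)) path detached (adj-sym sw)
          (proj₁ aw) ≤-refl cs cw (λ a → case proj₁ (Equivalence.to (c-g⇔ z≤n) a) of λ ()) c-inner w≢c
          (proj₁ aw) ≤-refl cs cw (1+n≰n ∘ proj₂ ∘ Equivalence.to (c-g⇔ ≤-refl))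
          (λ t 1≤t t≤d → c-inner (suc d ∸ t) (subst (1 ≤_) (sym (+-∸-assoc 1 t≤d)) (s≤s z≤n))
                                              (∸-monoʳ-≤ (suc d) 1≤t))
          w≢c
        replace : (∀ t → t ≤ suc d → ¬ Adj G w (g t)) → ShallowTerminal G w
        replace none with replace-shallow (proj₂ aw) w refl
            (λ _ → refl) (λ _ → refl) (λ _ → refl) (λ _ → refl)
            (λ { fzero → adj-sym cw }) (missed-bases none) (λ { fzero → w≢c })
            (neighbour-of-shallow∉bases (adj-sym sw))
        ... | φ′ , copy′ , refl = inj₁ (d , φ′ , (proj₁ aw , copy′) , refl)

    module _ {d : ℕ} {φ : AWV 2 d → V} (aw : DDaggerAW G d φ) where

      open AWBasePath (proj₂ aw) (λ _ _ → refl) (λ _ → refl)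

      private
        s c₁ c₂ : V
        s = φ shallow
        c₁ = φ (centre fzero)
        c₂ = φ (centre (fsuc fzero))
        c₁s : Adj G c₁ s
        c₁s = Equivalence.from (adj⇔pat (centre fzero) shallow) refl
        c₂s : Adj G c₂ s
        c₂s = Equivalence.from (adj⇔pat (centre (fsuc fzero)) shallow) refl
        c₁-g⇔ : ∀ {t} → t ≤ suc d → Adj G c₁ (g t) ⇔ t ≤ d
        c₁-g⇔ t≤ = adj-g⇔ (centre fzero) t≤ innerOrL-true⇔
        c₂-g⇔ : ∀ {t} → t ≤ suc d → Adj G c₂ (g t) ⇔ 1 ≤ t
        c₂-g⇔ t≤ = adj-g⇔ (centre (fsuc fzero)) t≤ innerOrR-true⇔

      ddagger-reduces : ∀ w i → Adj G s w → inner i ≡ true → ¬ Adj G (φ (base i)) w →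
        ShallowTerminal G w ⊎ HasSmallerAW s d
      ddagger-reduces w i sw inn ¬bw with w ≟ᶠ c₁ | w ≟ᶠ c₂
      ... | yes refl | _ = ⊥-elim (¬bw (Equivalence.from (adj⇔pat (base i) (centre fzero))
                                          (Equivalence.from ∨-true⇔ (inj₁ inn))))
      ... | no _ | yes refl = ⊥-elim (¬bw (Equivalence.from (adj⇔pat (base i) (centre (fsuc fzero)))
                                          (Equivalence.from ∨-true⇔ (inj₁ inn))))
      ... | no w≢c₁ | no w≢c₂ = Data.Sum.map₁ replace
          (Sides.nonneighbour⇒detached-or-smaller (toℕ i) (proj₁ i-inner) (proj₂ i-inner)
             (λ a → ¬bw (adj-sym (subst (Adj G w) (g-toℕ i) a))))
        where
        i-inner : 1 ≤ toℕ i × toℕ i ≤ d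
        i-inner = Equivalence.to (inner-true⇔ i) inn
        c₁w : Adj G c₁ w
        c₁w = simplicial s (inj₂ (d , φ , aw , refl)) c₁ w (adj-sym c₁s) sw (w≢c₁ ∘ sym)
        c₂w : Adj G c₂ w
        c₂w = simplicial s (inj₂ (d , φ , aw , refl)) c₂ w (adj-sym c₂s) sw (w≢c₂ ∘ sym)
        module Sides = TwoCentred pre chordal (proj₁ aw) path detached (adj-sym sw)
          (s≤s (proj₁ aw)) (n≤1+n d) c₂s c₂w (λ a → case Equivalence.to (c₂-g⇔ z≤n) a of λ ())
          (λ t 1≤t t≤ → Equivalence.from (c₂-g⇔ t≤) 1≤t) w≢c₂
          (s≤s (proj₁ aw)) (n≤1+n d) c₁s c₁w (1+n≰n ∘ Equivalence.to (c₁-g⇔ ≤-refl))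
          (λ t 1≤t _ → Equivalence.from (c₁-g⇔ (m∸n≤m (suc d) t)) (∸-monoʳ-≤ (suc d) 1≤t)) w≢c₁
        replace : (∀ t → t ≤ suc d → ¬ Adj G w (g t)) → ShallowTerminal G w
        replace none with replace-shallow (proj₂ aw) w refl
            (λ { fzero → refl ; (fsuc fzero) → refl }) (λ { fzero → refl ; (fsuc fzero) → refl })
            (λ _ → refl) (λ _ → refl)
            (λ { fzero → adj-sym c₁w ; (fsuc fzero) → adj-sym c₂w }) (missed-bases none)
            (λ { fzero → w≢c₁ ; (fsuc fzero) → w≢c₂ }) (neighbour-of-shallow∉bases (adj-sym sw))
        ... | φ′ , copy′ , refl = inj₂ (d , φ′ , (proj₁ aw , copy′) , refl)

    dominating-or-smaller : ∀ {s d} → ShallowTerminalOfAW s d → DominatingAW s ⊎ HasSmallerAW s d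
    dominating-or-smaller (inj₁ (φ , aw , refl)) =
      Data.Sum.map₁ (λ dom → inj₁ (_ , φ , aw , dom)) (bases-dominate-or-smaller φ (dagger-reduces aw))
    dominating-or-smaller (inj₂ (φ , aw , refl)) =
      Data.Sum.map₁ (λ dom → inj₂ (_ , φ , aw , dom)) (bases-dominate-or-smaller φ (ddagger-reduces aw))

    dominating-by-size : ∀ {s d} → Acc _<_ d → ShallowTerminalOfAW s d → DominatingAW s
    dominating-by-size (acc smaller) aw with dominating-or-smaller aw
    ... | inj₁ dom = dom
    ... | inj₂ (_ , d′<d , aw′) = dominating-by-size (smaller d′<d) aw′

proposition8p2 : (G : Graph) → Nice G → (s : Fin (n G)) → ShallowTerminal G s →
    (∃ λ (d : ℕ) → ∃ λ (φ : AWV 1 d → Fin (n G)) → DaggerAW G d φ × BasesDominate G φ s)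
    ⊎ (∃ λ (d : ℕ) → ∃ λ (φ : AWV 2 d → Fin (n G)) → DDaggerAW G d φ × BasesDominate G φ s)
proposition8p2 G (pre , chordal , simplicial) s (inj₁ (d , †-AW)) =
  dominating-by-size G pre chordal simplicial (<-wellFounded d) (inj₁ †-AW)
proposition8p2 G (pre , chordal , simplicial) s (inj₂ (d , ‡-AW)) =
  dominating-by-size G pre chordal simplicial (<-wellFounded d) (inj₂ ‡-AW)
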